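{- Let $l\ge1$ and $k>2$ be integers and let $G$ be a graph. Let $T$ be the graph obtained by fully connecting a clique $K_k$ on $k$ vertices with an independent set $I$ of $k+1$ vertices, and let $G''$ be the disjoint union of $G$ and $T$. Then $h(G,l)\le k$ if and only if $h(G'',l+2)\le k$.
   Context: Graphs are finite, undirected, with no parallel edges and no isolated vertices. For $X\subseteq V$, $N(X)$ is the set of vertices with a neighbor in $X$. Given $W_1,\dots,W_l\subseteq V$, the rabbit territory is $R_1=V\setminus W_1$, $R_t=N(R_{t-1})\setminus W_t$ for $t\ge2$; $h(G,l)$ is the minimum $k$ such that there exist $W_1,\dots,W_l$ with $|W_t|\le k$ for all $t$ and $R_l=\emptyset$. -}

module Defs where

open import Data.Bool using (Bool; true; false; _∧_; _∨_; not)
open import Data.Nat using (ℕ; zero; suc; _+_; _≤_)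
open import Data.Fin using (Fin; splitAt; _≟_)
open import Data.Fin.Subset using (Subset; ⁅_⁆; _∩_; ∁; ⊥; ⊤; ∣_∣)
open import Data.Vec using (Vec; []; _∷_; tabulate; lookup)
open import Data.Vec.Relation.Unary.All using (All)
open import Data.Sum using (inj₁; inj₂)
open import Data.Product using (Σ; ∃; _×_)
open import Relation.Binary.PropositionalEquality using (_≡_)
open import Relation.Nullary.Decidable using (does)

record RawGraph : Set where
  constructor mkGraph
  field
    size : ℕ
    adj  : Fin size → Fin size → Bool
open RawGraph public

-- Well-formedness: undirected (symmetric), simple (no loops; parallel edges
-- are impossible in this representation) and no isolated vertices.
record IsGraph (G : RawGraph) : Set where
  field
    symmetric   : ∀ u v → adj G u v ≡ adj G v u
    irreflexive : ∀ v → adj G v v ≡ false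
    noIsolated  : ∀ v → ∃ λ u → adj G v u ≡ true

anyᵇ : ∀ {n} → (Fin n → Bool) → Bool
anyᵇ {zero}  f = false
anyᵇ {suc n} f = f Fin.zero ∨ anyᵇ (λ i → f (Fin.suc i))

N : (G : RawGraph) → Subset (size G) → Subset (size G)
N G X = tabulate λ v → anyᵇ λ u → lookup X u ∧ adj G u v

step : (G : RawGraph) → Subset (size G) → Subset (size G) → Subset (size G)
step G R W = N G R ∩ ∁ W

territoryFrom : (G : RawGraph) → ∀ {m} → Subset (size G) → Vec (Subset (size G)) m → Subset (size G)
territoryFrom G R []       = R
territoryFrom G R (W ∷ Ws) = territoryFrom G (step G R W) Ws

-- R_l for the strategy W_1, …, W_l (R_1 = V \ W_1). For l = 0 we set R_0 = V
-- (irrelevant: the theorem assumes l ≥ 1).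
territory : (G : RawGraph) → ∀ {l} → Vec (Subset (size G)) l → Subset (size G)
territory G []       = ⊤
territory G (W ∷ Ws) = territoryFrom G (∁ W) Ws

-- "h(G,l) ≤ k": since h(G,l) is the minimum k admitting a winning strategy of
-- length l with all |W_t| ≤ k, h(G,l) ≤ k holds iff such a strategy exists for k.
hLe : (G : RawGraph) → (l k : ℕ) → Set
hLe G l k = Σ (Vec (Subset (size G)) l) λ W →
  All (λ w → ∣ w ∣ ≤ k) W × territory G W ≡ ⊥

-- The graph T: a clique K_k (vertices 0..k-1) fully joined to an independent
-- set I of k+1 vertices (vertices k..2k).
T : ℕ → RawGraph
T k = mkGraph (k + suc k) a
  where
  a : Fin (k + suc k) → Fin (k + suc k) → Bool
  a u v with splitAt k u | splitAt k v
  ... | inj₁ i | inj₁ j = not (does (i ≟ j))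
  ... | inj₁ _ | inj₂ _ = true
  ... | inj₂ _ | inj₁ _ = true
  ... | inj₂ _ | inj₂ _ = false

_⊕_ : RawGraph → RawGraph → RawGraph
G ⊕ H = mkGraph (size G + size H) a
  where
  a : Fin (size G + size H) → Fin (size G + size H) → Bool
  a u v with splitAt (size G) u | splitAt (size G) v
  ... | inj₁ i | inj₁ j = adj G i j
  ... | inj₁ _ | inj₂ _ = false
  ... | inj₂ _ | inj₁ _ = false
  ... | inj₂ i | inj₂ j = adj H i j

-- Forward: play the given strategy on G, then hunt the clique K of T in the last two rounds;
-- after the first of them the rabbit is on I, all of whose neighbours lie in K.
-- Backward: split every hunter set of a strategy on G ⊕ T into its parts on G and on T. Since k
-- hunters cannot cover the k + 1 vertices of I, the rabbit's territory in T can only die out from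
-- inside I, in a round that hunts all of K and so leaves G unhunted. The round that drove the
-- rabbit into I leaves at most one hunter for G, and none unless the rabbit sat on a single clique
-- vertex, which it can only have reached from inside I. Hence the G-parts contain two consecutive
-- empty rounds, or a segment b, e, d, ∅ with ∣ b ∣, ∣ d ∣ ≤ 1. On a graph without isolated vertices,
-- dropping the two empty rounds, or replacing the segment by b ∪ d, e, does not enlarge the
-- rabbit's territory, and it keeps at most max(k, 2) = k hunters per round.

module Submission where

open import Data.Bool using (Bool; true; false; _∧_; _∨_; not)
open import Data.Bool.Properties using (∨-assoc; ∨-zeroʳ; ∨-identityʳ; ∧-zeroʳ; ∧-conicalˡ; ∧-conicalʳ)
open import Data.Empty using (⊥-elim)
open import Data.Fin using (Fin; zero; suc; _↑ˡ_; _↑ʳ_; splitAt; _≟_)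
open import Data.Fin.Properties using (splitAt-↑ˡ; splitAt-↑ʳ; splitAt⁻¹-↑ˡ; splitAt⁻¹-↑ʳ; any?; all?)
open import Data.Fin.Subset
  using (Subset; inside; outside; _∈_; _∉_; _⊆_; _∩_; _∪_; ∁; ⊥; ⊤; ⁅_⁆; ∣_∣; Nonempty; Empty)
open import Data.Fin.Subset.Properties
  using (_∈?_; nonempty?; ∈⊤; ∉⊥; ⊥⊆; x∈⁅x⁆; x∈⁅y⁆⇒x≡y; ∣⊤∣≡n; ∣⊥∣≡0; ∣⁅x⁆∣≡1; ⊆-antisym;
         p⊆q⇒∣p∣≤∣q∣; p⊆p∪q; q⊆p∪q; x∈p∩q⁺; x∈p∩q⁻; x∈∁p⇒x∉p; x∉p⇒x∈∁p)
open import Data.Nat using (ℕ; zero; suc; _+_; _≤_; _<_; z≤n; s≤s)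
import Data.Nat.Properties as ℕ
open import Data.Product using (∃; ∃₂; _×_; _,_; proj₂)
open import Data.Sum using (_⊎_; inj₁; inj₂)
open import Data.Vec using (Vec; []; _∷_; _++_; lookup; tabulate; replicate; zipWith; here; there)
import Data.Vec as Vec
open import Data.Vec.Properties
  using (lookup∘tabulate; tabulate-cong; map-++; zipWith-++; lookup-++ˡ; lookup-++ʳ; ++-injective;
         []=⇒lookup; lookup⇒[]=)
open import Data.Vec.Relation.Unary.All using (All; []; _∷_)
open import Function using (_∘_; id)
open import Function.Bundles using (_⇔_; mk⇔)
open import Relation.Binary.PropositionalEquality
  using (_≡_; _≢_; refl; sym; trans; cong; cong₂; subst; module ≡-Reasoning)
open import Relation.Nullary using (¬_; yes; no; Dec)
open import Relation.Nullary.Decidable using (_×-dec_; ¬?; dec-false; decidable-stable)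

open import Defs

private
  variable
    n m l L k : ℕ

anyᵇ⁺ : (f : Fin n → Bool) (i : Fin n) → f i ≡ true → anyᵇ f ≡ true
anyᵇ⁺ f zero    fi rewrite fi = refl
anyᵇ⁺ f (suc i) fi rewrite anyᵇ⁺ (f ∘ suc) i fi = ∨-zeroʳ (f zero)

anyᵇ⁻ : (f : Fin n → Bool) → anyᵇ f ≡ true → ∃ λ i → f i ≡ true
anyᵇ⁻ {suc n} f found with f zero in f0
... | true  = zero , f0
... | false with anyᵇ⁻ (f ∘ suc) found
...   | i , fi = suc i , fi

anyᵇ-cong : {f g : Fin n → Bool} → (∀ i → f i ≡ g i) → anyᵇ f ≡ anyᵇ g
anyᵇ-cong {zero}  f≗g = refl
anyᵇ-cong {suc n} f≗g = cong₂ _∨_ (f≗g zero) (anyᵇ-cong (f≗g ∘ suc))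

anyᵇ-false : {f : Fin n → Bool} → (∀ i → f i ≡ false) → anyᵇ f ≡ false
anyᵇ-false {zero}  f≗false = refl
anyᵇ-false {suc n} f≗false rewrite f≗false zero = anyᵇ-false (f≗false ∘ suc)

anyᵇ-+ : ∀ n (f : Fin (n + m) → Bool) → anyᵇ f ≡ anyᵇ (f ∘ (_↑ˡ m)) ∨ anyᵇ (f ∘ (n ↑ʳ_))
anyᵇ-+ zero    f = refl
anyᵇ-+ (suc n) f = trans (cong (f zero ∨_) (anyᵇ-+ n (f ∘ suc))) (sym (∨-assoc (f zero) _ _))

tabulate-+ : ∀ n {A : Set} (f : Fin (n + m) → A) →
             tabulate f ≡ tabulate (f ∘ (_↑ˡ m)) ++ tabulate (f ∘ (n ↑ʳ_))
tabulate-+ zero    f = refl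
tabulate-+ (suc n) f = cong (f zero ∷_) (tabulate-+ n (f ∘ suc))

replicate-+ : ∀ n {A : Set} {x : A} → replicate (n + m) x ≡ replicate n x ++ replicate m x
replicate-+ zero    = refl
replicate-+ (suc n) = cong (_ ∷_) (replicate-+ n)

∣p++q∣≡∣p∣+∣q∣ : (p : Subset n) (q : Subset m) → ∣ p ++ q ∣ ≡ ∣ p ∣ + ∣ q ∣
∣p++q∣≡∣p∣+∣q∣ []            q = refl
∣p++q∣≡∣p∣+∣q∣ (inside  ∷ p) q = cong suc (∣p++q∣≡∣p∣+∣q∣ p q)
∣p++q∣≡∣p∣+∣q∣ (outside ∷ p) q = ∣p++q∣≡∣p∣+∣q∣ p q

∣p∪q∣≤∣p∣+∣q∣ : (p q : Subset n) → ∣ p ∪ q ∣ ≤ ∣ p ∣ + ∣ q ∣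
∣p∪q∣≤∣p∣+∣q∣ []            []            = z≤n
∣p∪q∣≤∣p∣+∣q∣ (inside  ∷ p) (inside  ∷ q) =
  s≤s (ℕ.≤-trans (∣p∪q∣≤∣p∣+∣q∣ p q) (ℕ.+-monoʳ-≤ ∣ p ∣ (ℕ.n≤1+n ∣ q ∣)))
∣p∪q∣≤∣p∣+∣q∣ (inside  ∷ p) (outside ∷ q) = s≤s (∣p∪q∣≤∣p∣+∣q∣ p q)
∣p∪q∣≤∣p∣+∣q∣ (outside ∷ p) (inside  ∷ q) =
  ℕ.≤-trans (s≤s (∣p∪q∣≤∣p∣+∣q∣ p q)) (ℕ.≤-reflexive (sym (ℕ.+-suc ∣ p ∣ ∣ q ∣)))
∣p∪q∣≤∣p∣+∣q∣ (outside ∷ p) (outside ∷ q) = ∣p∪q∣≤∣p∣+∣q∣ p q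

∣p∣≡0⇒p≡⊥ : {p : Subset n} → ∣ p ∣ ≡ 0 → p ≡ ⊥
∣p∣≡0⇒p≡⊥ {p = []}          _     = refl
∣p∣≡0⇒p≡⊥ {p = outside ∷ p} ∣p∣≡0 = cong (outside ∷_) (∣p∣≡0⇒p≡⊥ ∣p∣≡0)

∈-++⁺ˡ : {p : Subset n} {q : Subset m} {i : Fin n} → i ∈ p → i ↑ˡ m ∈ p ++ q
∈-++⁺ˡ here      = here
∈-++⁺ˡ (there h) = there (∈-++⁺ˡ h)

∈-++⁻ˡ : {p : Subset n} {q : Subset m} {i : Fin n} → i ↑ˡ m ∈ p ++ q → i ∈ p
∈-++⁻ˡ {p = _ ∷ _} {i = zero}  here      = here
∈-++⁻ˡ {p = _ ∷ _} {i = suc i} (there h) = there (∈-++⁻ˡ h)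

∈-++⁻ʳ : (p : Subset n) {q : Subset m} {j : Fin m} → n ↑ʳ j ∈ p ++ q → j ∈ q
∈-++⁻ʳ []      h         = h
∈-++⁻ʳ (_ ∷ p) (there h) = ∈-++⁻ʳ p h

Bounded : ℕ → Vec (Subset n) L → Set
Bounded k Ws = All (λ W → ∣ W ∣ ≤ k) Ws

module _ (a : Subset n) (w : Subset m) (bounded : ∣ a ++ w ∣ ≤ k) where

  private
    sum-bounded : ∣ a ∣ + ∣ w ∣ ≤ k
    sum-bounded = subst (_≤ k) (∣p++q∣≡∣p∣+∣q∣ a w) bounded

  ++-boundedˡ : ∣ a ∣ ≤ k
  ++-boundedˡ = ℕ.≤-trans (ℕ.m≤m+n ∣ a ∣ ∣ w ∣) sum-bounded

  ++-boundedʳ : ∣ w ∣ ≤ k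
  ++-boundedʳ = ℕ.≤-trans (ℕ.m≤n+m ∣ w ∣ ∣ a ∣) sum-bounded

  ++-saturatedʳ⇒≡⊥ : k ≤ ∣ w ∣ → a ≡ ⊥
  ++-saturatedʳ⇒≡⊥ k≤∣w∣ =
    ∣p∣≡0⇒p≡⊥ (ℕ.n≤0⇒n≡0 (ℕ.+-cancelʳ-≤ ∣ w ∣ ∣ a ∣ 0 (ℕ.≤-trans sum-bounded k≤∣w∣)))

  ++-nearlySaturatedʳ⇒≤1 : k ≤ suc ∣ w ∣ → ∣ a ∣ ≤ 1
  ++-nearlySaturatedʳ⇒≤1 k≤1+∣w∣ = ℕ.+-cancelʳ-≤ ∣ w ∣ ∣ a ∣ 1 (ℕ.≤-trans sum-bounded k≤1+∣w∣)

zipWith-++-boundedˡ : {as : Vec (Subset n) L} {ws : Vec (Subset m) L} →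
                      Bounded k (zipWith _++_ as ws) → Bounded k as
zipWith-++-boundedˡ {as = []}    {[]}    []       = []
zipWith-++-boundedˡ {as = a ∷ _} {w ∷ _} (h ∷ hs) = ++-boundedˡ a w h ∷ zipWith-++-boundedˡ hs

-- Neighbourhoods and rounds

Edge : (G : RawGraph) → Fin (size G) → Fin (size G) → Set
Edge G u v = adj G u v ≡ true

module Rounds (G : RawGraph) where

  private
    variable
      u v : Fin (size G)
      R R′ W W′ X : Subset (size G)

  ∈N⁺ : u ∈ X → Edge G u v → v ∈ N G X
  ∈N⁺ {u} {X} {v} u∈X e = lookup⇒[]= v (N G X)
    (trans (lookup∘tabulate _ v) (anyᵇ⁺ _ u (cong₂ _∧_ ([]=⇒lookup u∈X) e)))

  ∈N⁻ : ∀ X → v ∈ N G X → ∃ λ u → u ∈ X × Edge G u v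
  ∈N⁻ {v} X v∈N with anyᵇ⁻ _ (trans (sym (lookup∘tabulate _ v)) ([]=⇒lookup v∈N))
  ... | u , Xu∧e = u , lookup⇒[]= u X (∧-conicalˡ _ _ Xu∧e) , ∧-conicalʳ _ _ Xu∧e

  ∈step⁺ : u ∈ R → Edge G u v → v ∉ W → v ∈ step G R W
  ∈step⁺ {R = R} {W = W} u∈R e v∉W = x∈p∩q⁺ {p = N G R} {q = ∁ W} (∈N⁺ u∈R e , x∉p⇒x∈∁p v∉W)

  ∈step⁻ : ∀ R W → v ∈ step G R W → (∃ λ u → u ∈ R × Edge G u v) × v ∉ W
  ∈step⁻ R W v∈step with x∈p∩q⁻ (N G R) (∁ W) v∈step
  ... | v∈N , v∈∁W = ∈N⁻ R v∈N , x∈∁p⇒x∉p v∈∁W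

  blocked : u ∈ R → Edge G u v → v ∉ step G R W → v ∈ W
  blocked {v = v} {W = W} u∈R e v∉step = decidable-stable (v ∈? W) (v∉step ∘ ∈step⁺ u∈R e)

  step-monoˡ : ∀ W → R ⊆ R′ → step G R W ⊆ step G R′ W
  step-monoˡ {R} W R⊆R′ v∈step with ∈step⁻ R W v∈step
  ... | (u , u∈R , e) , v∉W = ∈step⁺ (R⊆R′ u∈R) e v∉W

  step-antitoneʳ : ∀ R → W′ ⊆ W → step G R W ⊆ step G R W′
  step-antitoneʳ {W = W} R W′⊆W v∈step with ∈step⁻ R W v∈step
  ... | (u , u∈R , e) , v∉W = ∈step⁺ u∈R e (v∉W ∘ W′⊆W)

  step-⊥ : step G ⊥ W ≡ ⊥
  step-⊥ {W} = ⊆-antisym ⊆⊥ ⊥⊆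
    where
    ⊆⊥ : step G ⊥ W ⊆ ⊥
    ⊆⊥ v∈step with ∈step⁻ ⊥ W v∈step
    ... | (_ , u∈⊥ , _) , _ = ⊥-elim (∉⊥ u∈⊥)

  territoryFrom-mono : (Ws : Vec (Subset (size G)) L) → R ⊆ R′ →
                       territoryFrom G R Ws ⊆ territoryFrom G R′ Ws
  territoryFrom-mono []       R⊆R′ = R⊆R′
  territoryFrom-mono (W ∷ Ws) R⊆R′ = territoryFrom-mono Ws (step-monoˡ W R⊆R′)

  territoryFrom-++ : (Ws : Vec (Subset (size G)) L) (Us : Vec (Subset (size G)) l) →
                     territoryFrom G R (Ws ++ Us) ≡ territoryFrom G (territoryFrom G R Ws) Us
  territoryFrom-++ []       Us = refl
  territoryFrom-++ (W ∷ Ws) Us = territoryFrom-++ Ws Us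

  territoryFrom-⊥ : (Ws : Vec (Subset (size G)) L) → territoryFrom G ⊥ Ws ≡ ⊥
  territoryFrom-⊥ []       = refl
  territoryFrom-⊥ (W ∷ Ws) rewrite step-⊥ {W = W} = territoryFrom-⊥ Ws

  territoryFrom-⊤⊆territory : (Ws : Vec (Subset (size G)) L) → territoryFrom G ⊤ Ws ⊆ territory G Ws
  territoryFrom-⊤⊆territory []       = id
  territoryFrom-⊤⊆territory (W ∷ Ws) = territoryFrom-mono Ws (x∉p⇒x∈∁p ∘ proj₂ ∘ ∈step⁻ ⊤ W)

-- Contracting strategies

data Contraction : Vec (Subset n) (2 + L) → Vec (Subset n) L → Set where
  skip  : (ys : Vec (Subset n) L) → Contraction (⊥ ∷ ⊥ ∷ ys) ys
  merge : {b d : Subset n} (e : Subset n) (ys : Vec (Subset n) L) → ∣ b ∣ ≤ 1 → ∣ d ∣ ≤ 1 →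
          Contraction (b ∷ e ∷ d ∷ ⊥ ∷ ys) (b ∪ d ∷ e ∷ ys)
  _∷_   : (x : Subset n) {as : Vec (Subset n) (2 + L)} {cs : Vec (Subset n) L} →
          Contraction as cs → Contraction (x ∷ as) (x ∷ cs)

data Contractible : Vec (Subset n) L → Set where
  contractsTo : {as : Vec (Subset n) (2 + L)} (cs : Vec (Subset n) L) →
                Contraction as cs → Contractible as

infixr 5 _∷ᶜ_

_∷ᶜ_ : (x : Subset n) {as : Vec (Subset n) L} → Contractible as → Contractible (x ∷ as)
x ∷ᶜ contractsTo cs c = contractsTo (x ∷ cs) (x ∷ c)

contraction-bounded : 2 ≤ k → {as : Vec (Subset n) (2 + L)} {cs : Vec (Subset n) L} →
                      Contraction as cs → Bounded k as → Bounded k cs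
contraction-bounded _   (skip ys) (_ ∷ _ ∷ hs) = hs
contraction-bounded 2≤k (x ∷ c)   (h ∷ hs)     = h ∷ contraction-bounded 2≤k c hs
contraction-bounded 2≤k (merge {b = b} {d} e ys ∣b∣≤1 ∣d∣≤1) (_ ∷ he ∷ _ ∷ _ ∷ hs) =
  ℕ.≤-trans (∣p∪q∣≤∣p∣+∣q∣ b d) (ℕ.≤-trans (ℕ.+-mono-≤ ∣b∣≤1 ∣d∣≤1) 2≤k) ∷ he ∷ hs

module WithoutIsolatedVertices {G : RawGraph} (isGraph : IsGraph G) where

  open IsGraph isGraph
  open Rounds G

  private
    variable
      u v : Fin (size G)
      b d e X : Subset (size G)

    reverse : Edge G u v → Edge G v u
    reverse {u} {v} = trans (symmetric v u)

  territory⊆territoryFrom-⊤ : (Ws : Vec (Subset (size G)) L) → territory G Ws ⊆ territoryFrom G ⊤ Ws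
  territory⊆territoryFrom-⊤ []       = id
  territory⊆territoryFrom-⊤ (W ∷ Ws) = territoryFrom-mono Ws λ {v} v∈∁W →
    ∈step⁺ ∈⊤ (reverse (proj₂ (noIsolated v))) (x∈∁p⇒x∉p v∈∁W)

  idle-rounds : X ⊆ step G (step G X ⊥) ⊥
  idle-rounds {x = v} v∈X with noIsolated v
  ... | u , e = ∈step⁺ (∈step⁺ v∈X e ∉⊥) (reverse e) ∉⊥

  -- The rabbit reached y from a neighbour y′ ∉ b ∪ d; in the longer play it steps back to y′
  -- in round d and returns to y in the idle round.
  detour : step G (step G X (b ∪ d)) e ⊆ step G (step G (step G (step G X b) e) d) ⊥
  detour {X} {b} {d} {e} {y} y∈ with ∈step⁻ (step G X (b ∪ d)) e y∈
  ... | (y′ , y′∈ , edge) , _ = ∈step⁺ y′∈Y′ edge ∉⊥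
    where
    Y = step G (step G X b) e
    y∈Y : y ∈ Y
    y∈Y = step-monoˡ e (step-antitoneʳ X (p⊆p∪q {p = b} d)) y∈
    y′∈Y′ : y′ ∈ step G Y d
    y′∈Y′ = ∈step⁺ y∈Y (reverse edge) (proj₂ (∈step⁻ X (b ∪ d) y′∈) ∘ q⊆p∪q b d)

  territoryFrom-contraction : {R : Subset (size G)}
                              {as : Vec (Subset (size G)) (2 + L)} {cs : Vec (Subset (size G)) L} →
                              Contraction as cs → territoryFrom G R cs ⊆ territoryFrom G R as
  territoryFrom-contraction         (skip ys)        = territoryFrom-mono ys idle-rounds
  territoryFrom-contraction {R = R} (merge e ys _ _) = territoryFrom-mono ys (detour {X = R})
  territoryFrom-contraction         (x ∷ c)          = territoryFrom-contraction c

  contraction-clears : {as : Vec (Subset (size G)) (2 + L)} {cs : Vec (Subset (size G)) L} →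
                       Contraction as cs → territory G as ≡ ⊥ → territory G cs ≡ ⊥
  contraction-clears {as = as} {cs} c cleared = ⊆-antisym cs⊆⊥ ⊥⊆
    where
    cs⊆⊥ : territory G cs ⊆ ⊥
    cs⊆⊥ {v} = subst (v ∈_) cleared ∘ territoryFrom-⊤⊆territory as
             ∘ territoryFrom-contraction c ∘ territory⊆territoryFrom-⊤ cs

-- Disjoint unions

module _ (G H : RawGraph) where

  adj-⊕-ˡˡ : ∀ i j → adj (G ⊕ H) (i ↑ˡ size H) (j ↑ˡ size H) ≡ adj G i j
  adj-⊕-ˡˡ i j rewrite splitAt-↑ˡ (size G) i (size H) | splitAt-↑ˡ (size G) j (size H) = refl

  adj-⊕-ʳˡ : ∀ i j → adj (G ⊕ H) (size G ↑ʳ j) (i ↑ˡ size H) ≡ false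
  adj-⊕-ʳˡ i j rewrite splitAt-↑ˡ (size G) i (size H) | splitAt-↑ʳ (size G) (size H) j = refl

  adj-⊕-ˡʳ : ∀ i j → adj (G ⊕ H) (i ↑ˡ size H) (size G ↑ʳ j) ≡ false
  adj-⊕-ˡʳ i j rewrite splitAt-↑ˡ (size G) i (size H) | splitAt-↑ʳ (size G) (size H) j = refl

  adj-⊕-ʳʳ : ∀ i j → adj (G ⊕ H) (size G ↑ʳ i) (size G ↑ʳ j) ≡ adj H i j
  adj-⊕-ʳʳ i j rewrite splitAt-↑ʳ (size G) (size H) i | splitAt-↑ʳ (size G) (size H) j = refl

  N-⊕ : ∀ X Y → N (G ⊕ H) (X ++ Y) ≡ N G X ++ N H Y
  N-⊕ X Y = trans (tabulate-+ (size G) _) (cong₂ _++_ (tabulate-cong inG) (tabulate-cong inH))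
    where
    open ≡-Reasoning
    inG : ∀ i → anyᵇ (λ u → lookup (X ++ Y) u ∧ adj (G ⊕ H) u (i ↑ˡ size H))
              ≡ anyᵇ (λ u → lookup X u ∧ adj G u i)
    inG i = begin
      anyᵇ (λ u → lookup (X ++ Y) u ∧ adj (G ⊕ H) u (i ↑ˡ size H))
        ≡⟨ anyᵇ-+ (size G) _ ⟩
      anyᵇ (λ u → lookup (X ++ Y) (u ↑ˡ size H) ∧ adj (G ⊕ H) (u ↑ˡ size H) (i ↑ˡ size H))
        ∨ anyᵇ (λ u → lookup (X ++ Y) (size G ↑ʳ u) ∧ adj (G ⊕ H) (size G ↑ʳ u) (i ↑ˡ size H))
        ≡⟨ cong₂ _∨_ (anyᵇ-cong λ u → cong₂ _∧_ (lookup-++ˡ X Y u) (adj-⊕-ˡˡ u i))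
                     (anyᵇ-false λ u → trans (cong (_ ∧_) (adj-⊕-ʳˡ i u)) (∧-zeroʳ _)) ⟩
      anyᵇ (λ u → lookup X u ∧ adj G u i) ∨ false
        ≡⟨ ∨-identityʳ _ ⟩
      anyᵇ (λ u → lookup X u ∧ adj G u i) ∎
    inH : ∀ j → anyᵇ (λ u → lookup (X ++ Y) u ∧ adj (G ⊕ H) u (size G ↑ʳ j))
              ≡ anyᵇ (λ u → lookup Y u ∧ adj H u j)
    inH j = begin
      anyᵇ (λ u → lookup (X ++ Y) u ∧ adj (G ⊕ H) u (size G ↑ʳ j))
        ≡⟨ anyᵇ-+ (size G) _ ⟩
      anyᵇ (λ u → lookup (X ++ Y) (u ↑ˡ size H) ∧ adj (G ⊕ H) (u ↑ˡ size H) (size G ↑ʳ j))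
        ∨ anyᵇ (λ u → lookup (X ++ Y) (size G ↑ʳ u) ∧ adj (G ⊕ H) (size G ↑ʳ u) (size G ↑ʳ j))
        ≡⟨ cong₂ _∨_ (anyᵇ-false λ u → trans (cong (_ ∧_) (adj-⊕-ˡʳ u j)) (∧-zeroʳ _))
                     (anyᵇ-cong λ u → cong₂ _∧_ (lookup-++ʳ X Y u) (adj-⊕-ʳʳ u j)) ⟩
      anyᵇ (λ u → lookup Y u ∧ adj H u j) ∎

  step-⊕ : ∀ X Y W U → step (G ⊕ H) (X ++ Y) (W ++ U) ≡ step G X W ++ step H Y U
  step-⊕ X Y W U = begin
    N (G ⊕ H) (X ++ Y) ∩ ∁ (W ++ U)  ≡⟨ cong₂ _∩_ (N-⊕ X Y) (map-++ not W U) ⟩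
    (N G X ++ N H Y) ∩ (∁ W ++ ∁ U)  ≡⟨ zipWith-++ _∧_ (N G X) (N H Y) (∁ W) (∁ U) ⟩
    step G X W ++ step H Y U         ∎
    where open ≡-Reasoning

  territoryFrom-⊕ : ∀ X Y (Ws : Vec (Subset (size G)) L) (Us : Vec (Subset (size H)) L) →
                    territoryFrom (G ⊕ H) (X ++ Y) (zipWith _++_ Ws Us)
                      ≡ territoryFrom G X Ws ++ territoryFrom H Y Us
  territoryFrom-⊕ X Y []       []       = refl
  territoryFrom-⊕ X Y (W ∷ Ws) (U ∷ Us) rewrite step-⊕ X Y W U = territoryFrom-⊕ _ _ Ws Us

  territory-⊕ : (Ws : Vec (Subset (size G)) L) (Us : Vec (Subset (size H)) L) →
                territory (G ⊕ H) (zipWith _++_ Ws Us) ≡ territory G Ws ++ territory H Us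
  territory-⊕ []       []       = replicate-+ (size G)
  territory-⊕ (W ∷ Ws) (U ∷ Us) rewrite map-++ not W U = territoryFrom-⊕ (∁ W) (∁ U) Ws Us

  territory-⊕≡⊥ : (Ws : Vec (Subset (size G)) L) (Us : Vec (Subset (size H)) L) →
                  territory (G ⊕ H) (zipWith _++_ Ws Us) ≡ ⊥ → territory G Ws ≡ ⊥ × territory H Us ≡ ⊥
  territory-⊕≡⊥ Ws Us cleared =
    ++-injective (territory G Ws) ⊥ (trans (sym (territory-⊕ Ws Us)) (trans cleared (replicate-+ (size G))))

zipWith-++-surjective : ∀ n (A : Vec (Subset (n + m)) L) →
                        ∃₂ λ (as : Vec (Subset n) L) (ws : Vec (Subset m) L) → A ≡ zipWith _++_ as ws
zipWith-++-surjective n []      = [] , [] , refl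
zipWith-++-surjective n (W ∷ A) with Vec.splitAt n W | zipWith-++-surjective n A
... | a , w , refl | as , ws , refl = a ∷ as , w ∷ ws , refl

-- The graph T

module TGraph (k : ℕ) where

  open Rounds (T k)

  private
    variable
      R w : Subset (k + suc k)

  K : Fin k → Fin (k + suc k)
  K c = c ↑ˡ suc k

  I : Fin (suc k) → Fin (k + suc k)
  I i = k ↑ʳ i

  data Side : Fin (k + suc k) → Set where
    onK : ∀ c → Side (K c)
    onI : ∀ i → Side (I i)

  side : ∀ v → Side v
  side v with splitAt k v in eq
  ... | inj₁ c = subst Side (splitAt⁻¹-↑ˡ eq) (onK c)
  ... | inj₂ i = subst Side (splitAt⁻¹-↑ʳ eq) (onI i)

  K≢I : ∀ {c i} → K c ≢ I i
  K≢I {c} {i} Kc≡Ii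
    with trans (sym (splitAt-↑ˡ k c (suc k))) (trans (cong (splitAt k) Kc≡Ii) (splitAt-↑ʳ k (suc k) i))
  ... | ()

  K—K : ∀ {c d} → c ≢ d → Edge (T k) (K c) (K d)
  K—K {c} {d} c≢d rewrite splitAt-↑ˡ k c (suc k) | splitAt-↑ˡ k d (suc k) =
    cong not (dec-false (c ≟ d) c≢d)

  K—I : ∀ c i → Edge (T k) (K c) (I i)
  K—I c i rewrite splitAt-↑ˡ k c (suc k) | splitAt-↑ʳ k (suc k) i = refl

  I—K : ∀ i c → Edge (T k) (I i) (K c)
  I—K i c rewrite splitAt-↑ˡ k c (suc k) | splitAt-↑ʳ k (suc k) i = refl

  I≁I : ∀ i j → ¬ Edge (T k) (I i) (I j)
  I≁I i j rewrite splitAt-↑ʳ k (suc k) i | splitAt-↑ʳ k (suc k) j = λ ()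

  —K : ∀ {v c} → v ≢ K c → Edge (T k) v (K c)
  —K {v} v≢Kc with side v
  ... | onK d = K—K λ d≡c → v≢Kc (cong K d≡c)
  ... | onI i = I—K i _

  Kset : Subset (k + suc k)
  Kset = ⊤ {k} ++ ⊥ {suc k}

  K∈Kset : ∀ c → K c ∈ Kset
  K∈Kset c = ∈-++⁺ˡ {q = ⊥} ∈⊤

  I∉Kset : ∀ i → I i ∉ Kset
  I∉Kset i = ∉⊥ ∘ ∈-++⁻ʳ (⊤ {k})

  ∣Kset∣≡k : ∣ Kset ∣ ≡ k
  ∣Kset∣≡k = trans (∣p++q∣≡∣p∣+∣q∣ (⊤ {k}) (⊥ {suc k}))
                   (trans (cong₂ _+_ (∣⊤∣≡n k) (∣⊥∣≡0 (suc k))) (ℕ.+-identityʳ k))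

  Iset : Subset (k + suc k)
  Iset = ⊥ {k} ++ ⊤ {suc k}

  ∣Iset∣≡1+k : ∣ Iset ∣ ≡ suc k
  ∣Iset∣≡1+k = trans (∣p++q∣≡∣p∣+∣q∣ (⊥ {k}) (⊤ {suc k})) (cong₂ _+_ (∣⊥∣≡0 k) (∣⊤∣≡n (suc k)))

  K⊆⇒k≤∣w∣ : (∀ c → K c ∈ w) → k ≤ ∣ w ∣
  K⊆⇒k≤∣w∣ {w} K⊆w = subst (_≤ ∣ w ∣) ∣Kset∣≡k (p⊆q⇒∣p∣≤∣q∣ Kset⊆w)
    where
    Kset⊆w : Kset ⊆ w
    Kset⊆w {v} v∈Kset with side v
    ... | onK c = K⊆w c
    ... | onI i = ⊥-elim (I∉Kset i v∈Kset)

  I⊆⇒k<∣w∣ : (∀ i → I i ∈ w) → k < ∣ w ∣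
  I⊆⇒k<∣w∣ {w} I⊆w = subst (_≤ ∣ w ∣) ∣Iset∣≡1+k (p⊆q⇒∣p∣≤∣q∣ Iset⊆w)
    where
    Iset⊆w : Iset ⊆ w
    Iset⊆w {v} v∈Iset with side v
    ... | onK c = ⊥-elim (∉⊥ (∈-++⁻ˡ {q = ⊤ {suc k}} v∈Iset))
    ... | onI i = I⊆w i

  InsideI : Subset (k + suc k) → Set
  InsideI R = (∀ c → K c ∉ R) × ∃ λ i → I i ∈ R

  SingleK : Subset (k + suc k) → Set
  SingleK R = ∃ λ c → R ≡ ⁅ K c ⁆

  Free : Subset (k + suc k) → Set
  Free R = Nonempty R × ¬ InsideI R × ¬ SingleK R

  insideI? : ∀ R → Dec (InsideI R)
  insideI? R = all? (λ c → ¬? (K c ∈? R)) ×-dec any? (λ i → I i ∈? R)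

  InsideI⇒Nonempty : InsideI R → Nonempty R
  InsideI⇒Nonempty (_ , i , Ii∈R) = I i , Ii∈R

  meetsI : (∀ c → K c ∉ R) → Nonempty R → ∃ λ i → I i ∈ R
  meetsI noK (v , v∈R) with side v
  ... | onK c = ⊥-elim (noK c v∈R)
  ... | onI i = i , v∈R

  avoidsK : ∣ w ∣ ≤ k → (∀ i → I i ∉ step (T k) R w) → ∀ c → K c ∉ R
  avoidsK {w = w} w≤k I∉ c Kc∈R = ℕ.<⇒≱ (I⊆⇒k<∣w∣ {w = w} λ i → blocked Kc∈R (K—I c i) (I∉ i)) w≤k

  vanish⇒InsideI : ∣ w ∣ ≤ k → Nonempty R → Empty (step (T k) R w) → InsideI R
  vanish⇒InsideI {w = w} {R = R} w≤k ne cleared = noK , meetsI noK ne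
    where
    noK : ∀ c → K c ∉ R
    noK = avoidsK w≤k λ i Ii∈ → cleared (I i , Ii∈)

  vanish⇒k≤∣w∣ : InsideI R → Empty (step (T k) R w) → k ≤ ∣ w ∣
  vanish⇒k≤∣w∣ {w = w} (_ , i , Ii∈R) cleared =
    K⊆⇒k≤∣w∣ {w = w} λ c → blocked Ii∈R (I—K i c) λ Kc∈ → cleared (K c , Kc∈)

  enterI⇒source : InsideI (step (T k) R w) → ∃ λ c → K c ∈ R × (∀ d → d ≢ c → K d ∈ w)
  enterI⇒source {R = R} {w = w} (noK , i , Ii∈) with ∈step⁻ R w Ii∈
  ... | (u , u∈R , e) , _ with side u
  ...   | onI j = ⊥-elim (I≁I j i e)
  ...   | onK c = c , u∈R , λ d d≢c → blocked u∈R (K—K (d≢c ∘ sym)) (noK d)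

  enterI⇒k≤1+∣w∣ : InsideI (step (T k) R w) → k ≤ suc ∣ w ∣
  enterI⇒k≤1+∣w∣ {R = R} {w = w} inI with enterI⇒source {R = R} inI
  ... | c , _ , others = begin
    k                      ≤⟨ K⊆⇒k≤∣w∣ {w = ⁅ K c ⁆ ∪ w} K⊆ ⟩
    ∣ ⁅ K c ⁆ ∪ w ∣        ≤⟨ ∣p∪q∣≤∣p∣+∣q∣ ⁅ K c ⁆ w ⟩
    ∣ ⁅ K c ⁆ ∣ + ∣ w ∣    ≡⟨ cong (_+ ∣ w ∣) (∣⁅x⁆∣≡1 (K c)) ⟩
    suc ∣ w ∣              ∎
    where
    open ℕ.≤-Reasoning
    K⊆ : ∀ d → K d ∈ ⁅ K c ⁆ ∪ w
    K⊆ d with d ≟ c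
    ... | yes refl = p⊆p∪q w (x∈⁅x⁆ (K c))
    ... | no d≢c   = q⊆p∪q ⁅ K c ⁆ w (others d d≢c)

  enterI⇒k≤∣w∣⊎SingleK : InsideI (step (T k) R w) → k ≤ ∣ w ∣ ⊎ SingleK R
  enterI⇒k≤∣w∣⊎SingleK {R = R} {w = w} inI@(noK , _) with enterI⇒source {R = R} inI
  ... | c , Kc∈R , others with K c ∈? w
  ...   | yes Kc∈w = inj₁ (K⊆⇒k≤∣w∣ {w = w} K⊆w)
    where
    K⊆w : ∀ d → K d ∈ w
    K⊆w d with d ≟ c
    ... | yes refl = Kc∈w
    ... | no d≢c   = others d d≢c
  ...   | no Kc∉w = inj₂ (c , ⊆-antisym R⊆⁅Kc⁆ λ v∈ → subst (_∈ R) (sym (x∈⁅y⁆⇒x≡y (K c) v∈)) Kc∈R)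
    where
    R⊆⁅Kc⁆ : R ⊆ ⁅ K c ⁆
    R⊆⁅Kc⁆ {v} v∈R with v ≟ K c
    ... | yes refl = x∈⁅x⁆ (K c)
    ... | no v≢Kc  = ⊥-elim (noK c (∈step⁺ v∈R (—K v≢Kc) Kc∉w))

  SingleK-step⇒InsideI : ∣ w ∣ ≤ k → SingleK (step (T k) R w) → InsideI R
  SingleK-step⇒InsideI {w = w} {R = R} w≤k (c , step≡⁅Kc⁆) = noK , Ii∈R
    where
    noK : ∀ d → K d ∉ R
    noK = avoidsK w≤k λ i Ii∈ → K≢I (sym (x∈⁅y⁆⇒x≡y (K c) (subst (I i ∈_) step≡⁅Kc⁆ Ii∈)))
    Ii∈R : ∃ λ i → I i ∈ R
    Ii∈R with ∈step⁻ R w (subst (K c ∈_) (sym step≡⁅Kc⁆) (x∈⁅x⁆ (K c)))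
    ... | (u , u∈R , _) , _ = meetsI noK (u , u∈R)

  InsideI⇒¬InsideI-step : InsideI R → ¬ InsideI (step (T k) R w)
  InsideI⇒¬InsideI-step {R = R} {w = w} (noK , _) (_ , i , Ii∈) with ∈step⁻ R w Ii∈
  ... | (u , u∈R , e) , _ with side u
  ...   | onK c = noK c u∈R
  ...   | onI j = I≁I j i e

  twoKSweeps-clear : ∀ Y → territoryFrom (T k) Y (Kset ∷ Kset ∷ []) ≡ ⊥
  twoKSweeps-clear Y = ⊆-antisym ⊆⊥ ⊥⊆
    where
    ⊆⊥ : step (T k) (step (T k) Y Kset) Kset ⊆ ⊥
    ⊆⊥ {v} v∈ with ∈step⁻ (step (T k) Y Kset) Kset v∈
    ... | (u , u∈ , e) , v∉Kset with proj₂ (∈step⁻ Y Kset u∈) | side u | side v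
    ...   | u∉Kset | onK c | _     = ⊥-elim (u∉Kset (K∈Kset c))
    ...   | _      | onI i | onK c = ⊥-elim (v∉Kset (K∈Kset c))
    ...   | _      | onI i | onI j = ⊥-elim (I≁I i j e)

  data Shape (R : Subset (k + suc k)) : Set where
    empty   : Empty R → Shape R
    insideI : InsideI R → Shape R
    other   : Nonempty R → ¬ InsideI R → Shape R

  shape : ∀ R → Shape R
  shape R with nonempty? R | insideI? R
  ... | no ¬ne | _       = empty ¬ne
  ... | yes _  | yes inI = insideI inI
  ... | yes ne | no ¬inI = other ne ¬inI

  free-⊤ : Fin k → Free ⊤
  free-⊤ c = (I zero , ∈⊤) , (λ (noK , _) → noK c ∈⊤) ,
             λ (d , ⊤≡⁅Kd⁆) → K≢I (sym (x∈⁅y⁆⇒x≡y (K d) (subst (I zero ∈_) ⊤≡⁅Kd⁆ ∈⊤)))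

  -- The T-territory is followed round by round, carrying the G-parts as along. The states are:
  --   fromFree     a territory neither inside I nor a single clique vertex;
  --   fromIdleI    inside I, entered by a round with empty G-part;
  --   fromAfterI   just left I: b entered I, e left it, and ∣ b ∣ ≤ 1;
  --   fromDetourI  back inside I: b, e as before, d re-entered I, and ∣ d ∣ ≤ 1.
  -- T dies out only from inside I, in a round with empty G-part, so the states fromIdleI and
  -- fromDetourI end in a skip and a merge respectively.

  ClearsT : Subset (k + suc k) → Vec (Subset n) L → Vec (Subset (k + suc k)) L → Set
  ClearsT R as ws = Bounded k (zipWith _++_ as ws) × Empty (territoryFrom (T k) R ws)

  fromFree    : Free R → (as : Vec (Subset n) L) (ws : Vec (Subset (k + suc k)) L) →
                ClearsT R as ws → Contractible as
  fromIdleI   : InsideI R → (as : Vec (Subset n) L) (ws : Vec (Subset (k + suc k)) L) →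
                ClearsT R as ws → Contractible (⊥ ∷ as)
  fromAfterI  : {b e : Subset n} → Nonempty R → ¬ InsideI R → ∣ b ∣ ≤ 1 →
                (as : Vec (Subset n) L) (ws : Vec (Subset (k + suc k)) L) →
                ClearsT R as ws → Contractible (b ∷ e ∷ as)
  fromDetourI : {b e d : Subset n} → InsideI R → ∣ b ∣ ≤ 1 → ∣ d ∣ ≤ 1 →
                (as : Vec (Subset n) L) (ws : Vec (Subset (k + suc k)) L) →
                ClearsT R as ws → Contractible (b ∷ e ∷ d ∷ as)

  fromFree (ne , _) [] [] (_ , cleared) = ⊥-elim (cleared ne)
  fromFree {R = R} (ne , ¬inI , ¬single) (a ∷ as) (w ∷ ws) (h ∷ hs , cleared) with shape (step (T k) R w)
  ... | empty vanished = ⊥-elim (¬inI (vanish⇒InsideI (++-boundedʳ a w h) ne vanished))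
  ... | other ne′ ¬inI′ =
    a ∷ᶜ fromFree (ne′ , ¬inI′ , ¬inI ∘ SingleK-step⇒InsideI (++-boundedʳ a w h)) as ws (hs , cleared)
  ... | insideI inI with enterI⇒k≤∣w∣⊎SingleK {R = R} inI
  ...   | inj₂ single = ⊥-elim (¬single single)
  ...   | inj₁ k≤∣w∣ rewrite ++-saturatedʳ⇒≡⊥ a w h k≤∣w∣ = fromIdleI inI as ws (hs , cleared)

  fromIdleI inI [] [] (_ , cleared) = ⊥-elim (cleared (InsideI⇒Nonempty inI))
  fromIdleI {R = R} {n = n} inI (a ∷ as) (w ∷ ws) (h ∷ hs , cleared) with shape (step (T k) R w)
  ... | empty vanished rewrite ++-saturatedʳ⇒≡⊥ a w h (vanish⇒k≤∣w∣ inI vanished) =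
    contractsTo as (skip as)
  ... | insideI inI′  = ⊥-elim (InsideI⇒¬InsideI-step inI inI′)
  ... | other ne ¬inI =
    fromAfterI ne ¬inI (subst (_≤ 1) (sym (∣⊥∣≡0 n)) z≤n) as ws (hs , cleared)

  fromAfterI ne _ _ [] [] (_ , cleared) = ⊥-elim (cleared ne)
  fromAfterI {R = R} {b = b} {e} ne ¬inI ∣b∣≤1 (a ∷ as) (w ∷ ws) (h ∷ hs , cleared)
    with shape (step (T k) R w)
  ... | empty vanished = ⊥-elim (¬inI (vanish⇒InsideI (++-boundedʳ a w h) ne vanished))
  ... | insideI inI    =
    fromDetourI inI ∣b∣≤1 (++-nearlySaturatedʳ⇒≤1 a w h (enterI⇒k≤1+∣w∣ {R = R} inI))
                as ws (hs , cleared)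
  ... | other ne′ ¬inI′ =
    b ∷ᶜ e ∷ᶜ a ∷ᶜ fromFree (ne′ , ¬inI′ , ¬inI ∘ SingleK-step⇒InsideI (++-boundedʳ a w h))
                            as ws (hs , cleared)

  fromDetourI inI _ _ [] [] (_ , cleared) = ⊥-elim (cleared (InsideI⇒Nonempty inI))
  fromDetourI {R = R} {b = b} {e} {d} inI ∣b∣≤1 ∣d∣≤1 (a ∷ as) (w ∷ ws) (h ∷ hs , cleared)
    with shape (step (T k) R w)
  ... | empty vanished rewrite ++-saturatedʳ⇒≡⊥ a w h (vanish⇒k≤∣w∣ inI vanished) =
    contractsTo (b ∪ d ∷ e ∷ as) (merge e as ∣b∣≤1 ∣d∣≤1)
  ... | insideI inI′  = ⊥-elim (InsideI⇒¬InsideI-step inI inI′)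
  ... | other ne ¬inI = b ∷ᶜ e ∷ᶜ fromAfterI ne ¬inI ∣d∣≤1 as ws (hs , cleared)

  T-cleared⇒contractible : Fin k → (as : Vec (Subset n) L) (ws : Vec (Subset (k + suc k)) L) →
                           Bounded k (zipWith _++_ as ws) → territory (T k) ws ≡ ⊥ → Contractible as
  T-cleared⇒contractible c as ws bounded cleared = fromFree (free-⊤ c) as ws (bounded , vanishes)
    where
    vanishes : Empty (territoryFrom (T k) ⊤ ws)
    vanishes (v , v∈) = ∉⊥ (subst (v ∈_) cleared (territoryFrom-⊤⊆territory ws v∈))

  sweepAfter : Vec (Subset n) l → Vec (Subset (n + (k + suc k))) (l + 2)
  sweepAfter {l = l} Ws = zipWith _++_ (Ws ++ ⊥ ∷ ⊥ ∷ []) (replicate l ⊥ ++ Kset ∷ Kset ∷ [])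

  sweepAfter-bounded : {Ws : Vec (Subset n) l} → Bounded k Ws → Bounded k (sweepAfter Ws)
  sweepAfter-bounded {n = n} [] = sweepRound ∷ sweepRound ∷ []
    where
    sweepRound : ∣ ⊥ {n} ++ Kset ∣ ≤ k
    sweepRound = ℕ.≤-reflexive (trans (∣p++q∣≡∣p∣+∣q∣ (⊥ {n}) Kset) (cong₂ _+_ (∣⊥∣≡0 n) ∣Kset∣≡k))
  sweepAfter-bounded {Ws = W ∷ _} (h ∷ hs) = subst (_≤ k) (sym ∣W++⊥∣≡∣W∣) h ∷ sweepAfter-bounded hs
    where
    ∣W++⊥∣≡∣W∣ : ∣ W ++ ⊥ {k + suc k} ∣ ≡ ∣ W ∣
    ∣W++⊥∣≡∣W∣ = trans (∣p++q∣≡∣p∣+∣q∣ W ⊥)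
                       (trans (cong (∣ W ∣ +_) (∣⊥∣≡0 (k + suc k))) (ℕ.+-identityʳ _))

  sweepAfter-clears : (G : RawGraph) (W : Subset (size G)) (Ws : Vec (Subset (size G)) l) →
                      territory G (W ∷ Ws) ≡ ⊥ → territory (G ⊕ T k) (sweepAfter (W ∷ Ws)) ≡ ⊥
  sweepAfter-clears {l = l} G W Ws cleared = begin
    territory (G ⊕ T k) (sweepAfter (W ∷ Ws))
      ≡⟨ territory-⊕ G (T k) (W ∷ Ws ++ ⊥ ∷ ⊥ ∷ []) (⊥ ∷ replicate l ⊥ ++ Kset ∷ Kset ∷ []) ⟩
    territoryFrom G (∁ W) (Ws ++ ⊥ ∷ ⊥ ∷ [])
      ++ territoryFrom (T k) (∁ ⊥) (replicate l ⊥ ++ Kset ∷ Kset ∷ [])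
      ≡⟨ cong₂ _++_ G-cleared T-cleared ⟩
    ⊥ {size G} ++ ⊥ {k + suc k}
      ≡⟨ replicate-+ (size G) ⟨
    ⊥ ∎
    where
    open ≡-Reasoning
    G-cleared : territoryFrom G (∁ W) (Ws ++ ⊥ ∷ ⊥ ∷ []) ≡ ⊥
    G-cleared = begin
      territoryFrom G (∁ W) (Ws ++ ⊥ ∷ ⊥ ∷ [])
        ≡⟨ Rounds.territoryFrom-++ G Ws (⊥ ∷ ⊥ ∷ []) ⟩
      territoryFrom G (territory G (W ∷ Ws)) (⊥ ∷ ⊥ ∷ [])
        ≡⟨ cong (λ X → territoryFrom G X (⊥ ∷ ⊥ ∷ [])) cleared ⟩
      territoryFrom G ⊥ (⊥ ∷ ⊥ ∷ [])
        ≡⟨ Rounds.territoryFrom-⊥ G (⊥ ∷ ⊥ ∷ []) ⟩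
      ⊥ ∎
    T-cleared : territoryFrom (T k) (∁ ⊥) (replicate l ⊥ ++ Kset ∷ Kset ∷ []) ≡ ⊥
    T-cleared = trans (territoryFrom-++ (replicate l ⊥) (Kset ∷ Kset ∷ []))
                      (twoKSweeps-clear (territoryFrom (T k) (∁ ⊥) (replicate l ⊥)))

forward : (G : RawGraph) → 1 ≤ l → hLe G l k → hLe (G ⊕ T k) (l + 2) k
forward {k = k} G (s≤s z≤n) (W ∷ Ws , bounded , cleared) =
  sweepAfter (W ∷ Ws) , sweepAfter-bounded bounded , sweepAfter-clears G W Ws cleared
  where open TGraph k

backward : 2 ≤ k → (G : RawGraph) → IsGraph G → hLe (G ⊕ T k) (2 + l) k → hLe G l k
backward {k = k} 2≤k@(s≤s (s≤s _)) G isGraph (A , bounded , cleared)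
  with zipWith-++-surjective (size G) A
... | as , ws , refl with territory-⊕≡⊥ G (T k) as ws cleared
... | G-cleared , T-cleared with TGraph.T-cleared⇒contractible k zero as ws bounded T-cleared
... | contractsTo cs c =
  cs , contraction-bounded 2≤k c (zipWith-++-boundedˡ bounded) ,
  WithoutIsolatedVertices.contraction-clears isGraph c G-cleared

lemma9 : (l k : ℕ) → 1 ≤ l → 2 < k → (G : RawGraph) → IsGraph G →
    hLe G l k ⇔ hLe (G ⊕ T k) (l + 2) k
lemma9 l k 1≤l 2<k G isGraph = mk⇔
  (forward G 1≤l)
  (backward (ℕ.<⇒≤ 2<k) G isGraph ∘ subst (λ L → hLe (G ⊕ T k) L k) (ℕ.+-comm l 2))
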